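{- Let $\mathcal G = (\mathcal X\times \mathcal Y\times \mathcal Z,\ \mathcal A\times \mathcal B\times \mathcal C,\ Q,\ V)$ be a 3-player game with $\mathcal X = \mathcal Y = \mathcal Z = \{0,1\}$, arbitrary finite answer sets, $Q$ the uniform distribution over $\{(1,0,0),(0,1,0),(0,0,1)\}$, and such that $\mathrm{val}(\mathcal G)<1$. Then for every $n\in\mathbb N$, $\mathrm{val}(\mathcal G^{\otimes n})\le \rho_k(n)$, where $k=\max\{|\mathcal A|,|\mathcal B|,|\mathcal C|\}$.
   Context: For $k\in\mathbb N$, $\mathcal G_k$ is the 3-player game with question sets $\{0,1\}$, question distribution uniform over $\{(1,0,0),(0,1,0),(0,0,1)\}$, answer sets $\mathcal A_k=\mathcal B_k=\{0,1\}^k$ and $\mathcal C_k=[k]$, and predicate $V_k((x,y,z),(a,b,c))$ equal to: "$a_i\wedge b_i=0$ for all $i\in[k]$" if $(x,y,z)=(0,0,1)$; "$a_c=1$" if $(x,y,z)=(0,1,0)$; "$b_c=1$" if $(x,y,z)=(1,0,0)$. Define $\rho_k(n)=\mathrm{val}(\mathcal G_k^{\otimes n})$. The value of a game is the maximum over deterministic per-player strategies of the winning probability; $\mathcal G^{\otimes n}$ is the $n$-fold parallel repetition (i.i.d. questions in $n$ coordinates, each player answers all its coordinates as a function of all its questions, win iff all coordinates are won). -}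

module Defs where

open import Data.Nat using (ℕ; zero; suc; _⊔_; _≤_)
open import Data.Bool using (Bool; true; false; _∧_; not)
open import Data.Fin using (Fin; zero; suc)
open import Data.Vec using (Vec; []; _∷_; map; zipWith; lookup; foldr)
open import Data.List using (List; []; _∷_; _++_; concatMap)
open import Data.Product using (Σ; _×_; _,_)
open import Relation.Binary.PropositionalEquality using (_≡_)

-- A 3-player game whose question sets are X = Y = Z = Bool ({0,1}, false = 0,
-- true = 1), with answer sets A, B, C and a (decidable) predicate V.
-- The question distribution is fixed globally to be uniform over
-- {(1,0,0),(0,1,0),(0,0,1)}; the support is indexed by Fin 3 below.
record Game : Set₁ where
  field
    A B C : Set
    V : Bool → Bool → Bool → A → B → C → Bool
open Game public

qx qy qz : Fin 3 → Bool
qx zero = true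
qx (suc _) = false
qy (suc zero) = true
qy _ = false
qz (suc (suc zero)) = true
qz _ = false

record Strategy (G : Game) (n : ℕ) : Set where
  constructor strat
  field
    fa : Vec Bool n → Vec (A G) n
    fb : Vec Bool n → Vec (B G) n
    fc : Vec Bool n → Vec (C G) n
open Strategy public

-- all question tuples of G^{⊗n} in the support (3^n of them, each equally likely)
allQ : (n : ℕ) → List (Vec (Fin 3) n)
allQ zero = [] ∷ []
allQ (suc n) = concatMap (λ v → (zero ∷ v) ∷ (suc zero ∷ v) ∷ (suc (suc zero) ∷ v) ∷ []) (allQ n)

all : {n : ℕ} → Vec Bool n → Bool
all = foldr _ _∧_ true

wins : (G : Game) {n : ℕ} → Strategy G n → Vec (Fin 3) n → Bool
wins G {n} s q =
  let xs = map qx q ; ys = map qy q ; zs = map qz q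
      as = fa s xs ; bs = fb s ys ; cs = fc s zs
      coord : Fin n → Bool
      coord i = V G (lookup xs i) (lookup ys i) (lookup zs i)
                    (lookup as i) (lookup bs i) (lookup cs i)
  in all (Data.Vec.tabulate coord)

count : {X : Set} → (X → Bool) → List X → ℕ
count p [] = 0
count p (x ∷ xs) with p x
... | true = suc (count p xs)
... | false = count p xs

-- number of winning question tuples; winning probability = winCount / 3^n
winCount : (G : Game) {n : ℕ} → Strategy G n → ℕ
winCount G {n} s = count (wins G s) (allQ n)

-- val(G^{⊗n}) ≤ val(H^{⊗n}): every strategy for G^{⊗n} is matched or beaten
-- by some strategy for H^{⊗n} (both values are maxima over finitely many
-- strategies of winCount / 3^n)
ValLe : (G H : Game) (n : ℕ) → Set
ValLe G H n = (s : Strategy G n) → Σ (Strategy H n) (λ t → winCount G s ≤ winCount H t)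

-- val(G) < 1: every deterministic strategy loses on some question in the support
ValLtOne : Game → Set
ValLtOne G = (fa : Bool → A G) (fb : Bool → B G) (fc : Bool → C G) →
  Σ (Fin 3) (λ q → V G (qx q) (qy q) (qz q) (fa (qx q)) (fb (qy q)) (fc (qz q)) ≡ false)

Vk : (k : ℕ) → Bool → Bool → Bool → Vec Bool k → Vec Bool k → Fin k → Bool
Vk k false false true  a b c = all (zipWith (λ u v → not (u ∧ v)) a b)
Vk k false true  false a b c = lookup a c
Vk k true  false false a b c = lookup b c
Vk k _     _     _     a b c = true   -- questions outside the support (probability 0)

Gk : ℕ → Game
Gk k = record { A = Vec Bool k ; B = Vec Bool k ; C = Fin k ; V = Vk k }

mkGame : (a b c : ℕ) → (Bool → Bool → Bool → Fin a → Fin b → Fin c → Bool) → Game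
mkGame a b c V = record { A = Fin a ; B = Fin b ; C = Fin c ; V = V }

{-# OPTIONS --safe #-}
-- A strategy for G^{⊗n} can be translated into one for G_k^{⊗n} answer by answer, so it
-- suffices to map single answers of G to answers of G_k so that every winning triple of G
-- (on each of the three questions) becomes a winning triple of G_k. Charlie's answer γ is
-- sent to its label in [k]; Alice's answer α to the set of labels of those γ for which some
-- β makes (α, β, γ) win on (0,1,0); Bob's answer β to the set of labels of those γ for which
-- some α makes (α, β, γ) win on (1,0,0). The wins on (0,1,0) and (1,0,0) are then won in G_k
-- by construction, and a common label in the two sets of a winning triple on (0,0,1) would
-- give a strategy winning G on all three questions, which val(G) < 1 forbids.
module Submission where

open import Defs
open import Data.Nat using (ℕ; _⊔_; _≤_; z≤n; s≤s)
open import Data.Nat.Properties using (m≤n⊔m; m≤n⇒m≤1+n)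
open import Data.Bool using (Bool; true; false; T; _∧_; not; if_then_else_)
open import Data.Fin using (Fin; zero; suc; inject≤; _≟_)
open import Data.Fin.Properties using (any?; inject≤-injective)
open import Data.Vec using (Vec; []; _∷_; map; lookup; tabulate; zipWith)
open import Data.Vec.Properties using (lookup-map; lookup∘tabulate)
open import Data.List using (List; []; _∷_)
open import Data.Product using (∃₂; _×_; _,_)
open import Data.Empty using (⊥; ⊥-elim)
open import Function using (_∘_)
open import Relation.Nullary.Decidable using (isYes; T?; _×-dec_; toWitness; fromWitness)
open import Relation.Unary using (Decidable)
open import Relation.Binary.PropositionalEquality using (_≡_; refl; sym; subst)

all⁻ : ∀ {n} (v : Vec Bool n) → T (all v) → ∀ i → T (lookup v i)
all⁻ (true ∷ v) t zero    = _
all⁻ (true ∷ v) t (suc i) = all⁻ v t i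

all⁺ : ∀ {n} (v : Vec Bool n) → (∀ i → T (lookup v i)) → T (all v)
all⁺ []          h = _
all⁺ (true ∷ v)  h = all⁺ v (h ∘ suc)
all⁺ (false ∷ v) h = h zero

all-nand⁺ : ∀ {m} (u v : Vec Bool m) → (∀ j → T (lookup u j) → T (lookup v j) → ⊥) →
  T (all (zipWith (λ x y → not (x ∧ y)) u v))
all-nand⁺ []          []          h = _
all-nand⁺ (false ∷ u) (_ ∷ v)     h = all-nand⁺ u v (h ∘ suc)
all-nand⁺ (true ∷ u)  (false ∷ v) h = all-nand⁺ u v (h ∘ suc)
all-nand⁺ (true ∷ u)  (true ∷ v)  h = h zero _ _

indicator : ∀ {k} {P : Fin k → Set} → Decidable P → Vec Bool k
indicator P? = tabulate (isYes ∘ P?)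

module _ {k} {P : Fin k → Set} (P? : Decidable P) {j : Fin k} where

  indicator⁺ : P j → T (lookup (indicator P?) j)
  indicator⁺ p rewrite lookup∘tabulate (isYes ∘ P?) j = fromWitness p

  indicator⁻ : T (lookup (indicator P?) j) → P j
  indicator⁻ t rewrite lookup∘tabulate (isYes ∘ P?) j = toWitness t

count-mono : {X : Set} {p r : X → Bool} → (∀ x → T (p x) → T (r x)) →
  (xs : List X) → count p xs ≤ count r xs
count-mono {p = p} {r} p⇒r [] = z≤n
count-mono {p = p} {r} p⇒r (x ∷ xs) with p x | r x | p⇒r x
... | true  | true  | _   = s≤s (count-mono p⇒r xs)
... | true  | false | p⇒⊥ = ⊥-elim (p⇒⊥ _)
... | false | true  | _   = m≤n⇒m≤1+n (count-mono p⇒r xs)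
... | false | false | _   = count-mono p⇒r xs

-- The coordinate test of `wins`, so that `wins G s q` is `all (tabulate (winsAt G s q))` by definition.
winsAt : (G : Game) {n : ℕ} → Strategy G n → Vec (Fin 3) n → Fin n → Bool
winsAt G s q i =
  V G (lookup (map qx q) i) (lookup (map qy q) i) (lookup (map qz q) i)
      (lookup (fa s (map qx q)) i) (lookup (fb s (map qy q)) i) (lookup (fc s (map qz q)) i)

module _ (G : Game) {n : ℕ} (s : Strategy G n) (q : Vec (Fin 3) n) where

  wins⁻ : T (wins G s q) → ∀ i → T (winsAt G s q i)
  wins⁻ w i = subst T (lookup∘tabulate (winsAt G s q) i)
                      (all⁻ (tabulate (winsAt G s q)) w i)

  wins⁺ : (∀ i → T (winsAt G s q i)) → T (wins G s q)
  wins⁺ h = all⁺ (tabulate (winsAt G s q)) λ i →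
              subst T (sym (lookup∘tabulate (winsAt G s q) i)) (h i)

record GameMorphism (G H : Game) : Set where
  field
    mapA : A G → A H
    mapB : B G → B H
    mapC : C G → C H
    preserves-win : ∀ r {α β γ} → T (V G (qx r) (qy r) (qz r) α β γ) →
      T (V H (qx r) (qy r) (qz r) (mapA α) (mapB β) (mapC γ))

module _ {G H : Game} (f : GameMorphism G H) where
  open GameMorphism f

  mapStrategy : ∀ {n} → Strategy G n → Strategy H n
  mapStrategy s = strat (map mapA ∘ fa s) (map mapB ∘ fb s) (map mapC ∘ fc s)

  winsAt-mapStrategy : ∀ {n} (s : Strategy G n) q i →
    T (winsAt G s q i) → T (winsAt H (mapStrategy s) q i)
  winsAt-mapStrategy s q i w
    rewrite lookup-map i mapA (fa s (map qx q)) | lookup-map i mapB (fb s (map qy q))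
          | lookup-map i mapC (fc s (map qz q))
          | lookup-map i qx q | lookup-map i qy q | lookup-map i qz q
    = preserves-win (lookup q i) w

  wins-mapStrategy : ∀ {n} (s : Strategy G n) q → T (wins G s q) → T (wins H (mapStrategy s) q)
  wins-mapStrategy s q w =
    wins⁺ H (mapStrategy s) q λ i → winsAt-mapStrategy s q i (wins⁻ G s q w i)

  valLe-morphism : ∀ n → ValLe G H n
  valLe-morphism n s = mapStrategy s , count-mono (wins-mapStrategy s) (allQ n)

valLtOne⇒¬wins-all : ∀ {G} → ValLtOne G → ∀ {α₀ α₁ β₀ β₁ γ₀ γ₁} →
  T (V G true false false α₁ β₀ γ₀) → T (V G false true false α₀ β₁ γ₀) →
  T (V G false false true α₀ β₀ γ₁) → ⊥
valLtOne⇒¬wins-all vl {α₀} {α₁} {β₀} {β₁} {γ₀} {γ₁} w₁ w₂ w₃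
  with vl (λ x → if x then α₁ else α₀) (λ y → if y then β₁ else β₀) (λ z → if z then γ₁ else γ₀)
... | zero           , lost = subst T lost w₁
... | suc zero       , lost = subst T lost w₂
... | suc (suc zero) , lost = subst T lost w₃

module _ {a b c k : ℕ} (V : Bool → Bool → Bool → Fin a → Fin b → Fin c → Bool)
         (vl : ValLtOne (mkGame a b c V)) (c≤k : c ≤ k) where

  label : Fin c → Fin k
  label γ = inject≤ γ c≤k

  AliceCanWin : Fin a → Fin k → Set
  AliceCanWin α j = ∃₂ λ β γ → label γ ≡ j × T (V false true false α β γ)

  BobCanWin : Fin b → Fin k → Set
  BobCanWin β j = ∃₂ λ α γ → label γ ≡ j × T (V true false false α β γ)

  aliceCanWin? : ∀ α → Decidable (AliceCanWin α)
  aliceCanWin? α j = any? λ β → any? λ γ → label γ ≟ j ×-dec T? (V false true false α β γ)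

  bobCanWin? : ∀ β → Decidable (BobCanWin β)
  bobCanWin? β j = any? λ α → any? λ γ → label γ ≟ j ×-dec T? (V true false false α β γ)

  canWin-disjoint : ∀ {α β γ} → T (V false false true α β γ) →
    ∀ {j} → AliceCanWin α j → BobCanWin β j → ⊥
  canWin-disjoint w₃ (_ , γ₀ , refl , w₂) (_ , γ₀′ , same-label , w₁)
    rewrite inject≤-injective c≤k c≤k γ₀′ γ₀ same-label =
      valLtOne⇒¬wins-all {mkGame a b c V} vl w₁ w₂ w₃

  morphism-to-Gk : GameMorphism (mkGame a b c V) (Gk k)
  morphism-to-Gk = record
    { mapA = indicator ∘ aliceCanWin?
    ; mapB = indicator ∘ bobCanWin?
    ; mapC = label
    ; preserves-win = λ
        { zero                     w → indicator⁺ (bobCanWin? _) (_ , _ , refl , w)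
        ; (suc zero)               w → indicator⁺ (aliceCanWin? _) (_ , _ , refl , w)
        ; (suc (suc zero)) {α} {β} w →
            all-nand⁺ (indicator (aliceCanWin? α)) (indicator (bobCanWin? β)) λ _ inA inB →
              canWin-disjoint w (indicator⁻ (aliceCanWin? α) inA) (indicator⁻ (bobCanWin? β) inB)
        }
    }

proposition8p3 : (a b c : ℕ) (V : Bool → Bool → Bool → Fin a → Fin b → Fin c → Bool) →
    ValLtOne (mkGame a b c V) →
    (n : ℕ) → ValLe (mkGame a b c V) (Gk (a ⊔ b ⊔ c)) n
proposition8p3 a b c V vl = valLe-morphism (morphism-to-Gk V vl (m≤n⊔m (a ⊔ b) c))
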